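{- The class $\mathcal{ME}$ is closed under taking restrictions to modular flats: if $M\in\mathcal{ME}$ and $X$ is a modular flat of $M$, then $M|X\in\mathcal{ME}$.
   Context: All matroids are finite. For a simple matroid $M$ on ground set $E$ with rank function $r$, flats ordered by inclusion form the lattice $L(M)$, with $X\vee Y=\mathrm{cl}(X\cup Y)$. A coatom is a flat of rank $r(E)-1$. A flat $X$ is modular if $r(X)+r(Y)=r(X\cap Y)+r(X\vee Y)$ for all flats $Y$. A simple matroid $M$ is a modular join if $E=E_1\cup E_2$ for proper modular flats $E_1,E_2$; one writes $M=P_X(M|E_1,M|E_2)$ with $X=E_1\cap E_2$. A matroid is round if its ground set is not the union of two proper flats; a flat $S$ is round if $M|S$ is round. $\mathcal{ME}$ is the smallest class of simple matroids such that: (i) the empty matroid is in $\mathcal{ME}$; (ii) if a simple matroid $M$ has a modular coatom $X$ with $M|X\in\mathcal{ME}$, then $M\in\mathcal{ME}$; (iii) if $M$ is a modular join $P_X(M_1,M_2)$ over a round flat $X$ with $M_1,M_2\in\mathcal{ME}$, then $M\in\mathcal{ME}$. -}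

module Defs where

open import Data.Nat using (ℕ; suc; _≤_; _≡ᵇ_)
open import Data.Nat.Base using (_+_)
open import Data.Fin using (Fin)
open import Data.Fin.Subset using (Subset; _∈_; _∉_; _⊆_; _∪_; _∩_; ⁅_⁆; ∣_∣; ⊥; ⊤)
open import Data.Vec using (tabulate)
open import Data.Product using (Σ; _×_; ∃₂)
open import Relation.Binary.PropositionalEquality using (_≡_; _≢_)
open import Relation.Nullary using (¬_)

record Matroid (n : ℕ) : Set where
  field
    rank        : Subset n → ℕ
    rank-bound  : ∀ A → rank A ≤ ∣ A ∣
    rank-mono   : ∀ A B → A ⊆ B → rank A ≤ rank B
    rank-submod : ∀ A B → rank (A ∪ B) + rank (A ∩ B) ≤ rank A + rank B
open Matroid public

Simple : ∀ {n} → Matroid n → Set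
Simple M = (∀ e → rank M ⁅ e ⁆ ≡ 1)
         × (∀ e f → e ≢ f → rank M (⁅ e ⁆ ∪ ⁅ f ⁆) ≡ 2)

-- Throughout, the pair (M , S) with S ⊆ E stands for the restriction M|S;
-- all notions below are those of the matroid M|S (whose rank function is
-- the rank function of M restricted to subsets of S).

IsFlat : ∀ {n} → Matroid n → Subset n → Subset n → Set
IsFlat M S F = F ⊆ S × (∀ e → e ∈ S → e ∉ F → rank M (F ∪ ⁅ e ⁆) ≢ rank M F)

cl : ∀ {n} → Matroid n → Subset n → Subset n → Subset n
cl M S A = S ∩ tabulate (λ e → rank M (A ∪ ⁅ e ⁆) ≡ᵇ rank M A)

join : ∀ {n} → Matroid n → Subset n → Subset n → Subset n → Subset n
join M S X Y = cl M S (X ∪ Y)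

IsModularFlat : ∀ {n} → Matroid n → Subset n → Subset n → Set
IsModularFlat M S X =
  IsFlat M S X ×
  (∀ Y → IsFlat M S Y →
     rank M X + rank M Y ≡ rank M (X ∩ Y) + rank M (join M S X Y))

IsCoatom : ∀ {n} → Matroid n → Subset n → Subset n → Set
IsCoatom M S X = IsFlat M S X × suc (rank M X) ≡ rank M S

IsProperFlat : ∀ {n} → Matroid n → Subset n → Subset n → Set
IsProperFlat M S F = IsFlat M S F × F ≢ S

Round : ∀ {n} → Matroid n → Subset n → Set
Round M S = ¬ (∃₂ λ F₁ F₂ → IsProperFlat M S F₁ × IsProperFlat M S F₂ × F₁ ∪ F₂ ≡ S)

-- ME M S  means  M|S ∈ ME  (M simple, so every restriction is simple).
data ME {n : ℕ} (M : Matroid n) : Subset n → Set where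
  me-empty : ME M ⊥
  me-coatom : ∀ S X → IsModularFlat M S X → IsCoatom M S X → ME M X → ME M S
  me-join : ∀ S E₁ E₂ →
    IsModularFlat M S E₁ → E₁ ≢ S →
    IsModularFlat M S E₂ → E₂ ≢ S →
    E₁ ∪ E₂ ≡ S →
    Round M (E₁ ∩ E₂) →
    ME M E₁ → ME M E₂ → ME M S

-- Induction on the derivation of M|S ∈ ME.  The key closure property is that X ∩ T is a
-- modular flat of M|T whenever X is a modular flat and T a flat of M|S.  If X lies inside
-- the modular coatom H, or inside one of the parts E₁, E₂ of the modular join, one simply
-- restricts to it; otherwise X ∩ H is a modular coatom of M|X, respectively M|X is the
-- modular join of X ∩ E₁ and X ∩ E₂, and both pieces are in ME by induction.
--
-- What remains is that X ∩ E₁ ∩ E₂, a modular flat of the round matroid M|(E₁ ∩ E₂), is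
-- round.  For a modular flat Z of a round M|S, choose C ⊆ S skew to Z with C ∪ Z spanning S,
-- and send a flat F of M|Z to cl(F ∪ C).  Modularity keeps proper flats proper, and a cover
-- Z = F₁ ∪ F₂ becomes a cover of S: if f ∉ cl C, the flat cl(C + f) meets Z in rank one,
-- so in a point z ∈ F₁ ∪ F₂ with z ∉ cl C (as M has no loops), and exchanging z for f
-- puts f into cl(C + z).

module Submission where

open import Defs
open import Algebra.Bundles using (CommutativeMonoid)
import Algebra.Properties.CommutativeSemigroup as CommutativeSemigroupProperties
import Algebra.Properties.IdempotentCommutativeMonoid as IdempotentCommutativeMonoidProperties
open import Data.Bool.Properties using (T-≡)
open import Data.Empty using (⊥-elim)
open import Data.Fin using (Fin)
open import Data.Fin.Properties using (any?) renaming (_≟_ to _≟ᶠ_)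
open import Data.Fin.Subset
  using (Subset; ⊤; ⊥; _∈_; _∉_; _⊆_; _∪_; _∩_; ⁅_⁆; ∣_∣; Nonempty; _-_)
open import Data.Fin.Subset.Properties
open import Data.Nat using (ℕ; zero; suc; _+_; _≤_; _<_; z≤n; s≤s)
open import Data.Nat.Properties
open import Data.Product using (_×_; _,_; proj₁; proj₂; ∃)
open import Data.Sum using (inj₁; inj₂; [_,_])
open import Data.Vec.Properties using (lookup∘tabulate; []=⇒lookup; lookup⇒[]=)
open import Function.Base using (_∘_)
open import Function.Bundles using (Equivalence)
open import Relation.Nullary using (¬_; Dec; yes; no; contradiction)
open import Relation.Nullary.Decidable using (_×-dec_; ¬?; decidable-stable)
open import Relation.Binary.PropositionalEquality hiding ([_])

module _ {n : ℕ} where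

  ∪-lub : {A B C : Subset n} → A ⊆ C → B ⊆ C → A ∪ B ⊆ C
  ∪-lub {A} {B} A⊆C B⊆C x∈A∪B = [ A⊆C , B⊆C ] (x∈p∪q⁻ A B x∈A∪B)

  x∈p⇒⁅x⁆⊆p : {x : Fin n} {p : Subset n} → x ∈ p → ⁅ x ⁆ ⊆ p
  x∈p⇒⁅x⁆⊆p {x} x∈p y∈⁅x⁆ = subst (_∈ _) (sym (x∈⁅y⁆⇒x≡y x y∈⁅x⁆)) x∈p

  p⊆q⇒p∩q≡p : {p q : Subset n} → p ⊆ q → p ∩ q ≡ p
  p⊆q⇒p∩q≡p {p} {q} p⊆q = ⊆-antisym (p∩q⊆p p q) (λ x∈p → x∈p∩q⁺ (x∈p , p⊆q x∈p))

  p∩q≡p⇒p⊆q : {p q : Subset n} → p ∩ q ≡ p → p ⊆ q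
  p∩q≡p⇒p⊆q {p} {q} eq x∈p = p∩q⊆q p q (subst (_ ∈_) (sym eq) x∈p)

  p∪q∪r≡p∪r∪q : (p q r : Subset n) → (p ∪ q) ∪ r ≡ (p ∪ r) ∪ q
  p∪q∪r≡p∪r∪q = xy∙z≈xz∙y
    where
    open CommutativeSemigroupProperties
      (CommutativeMonoid.commutativeSemigroup (∪-commutativeMonoid n)) using (xy∙z≈xz∙y)

  p⊈q⇒∃ : {p q : Subset n} → ¬ p ⊆ q → ∃ λ x → x ∈ p × x ∉ q
  p⊈q⇒∃ {p} {q} p⊈q with any? (λ x → (x ∈? p) ×-dec ¬? (x ∈? q))
  ... | yes witness = witness
  ... | no none = ⊥-elim (p⊈q λ {x} x∈p →
    decidable-stable (x ∈? q) (λ x∉q → none (x , x∈p , x∉q)))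

module _ {n : ℕ} (M : Matroid n) where

  private
    r : Subset n → ℕ
    r = rank M

  rank-monotone : {A B : Subset n} → A ⊆ B → r A ≤ r B
  rank-monotone = rank-mono M _ _

  rank-⊥ : r ⊥ ≡ 0
  rank-⊥ = n≤0⇒n≡0 (subst (r ⊥ ≤_) (∣⊥∣≡0 n) (rank-bound M ⊥))

  rank-∪≤ : (A B : Subset n) → r (A ∪ B) ≤ r A + r B
  rank-∪≤ A B = ≤-trans (m≤m+n _ _) (rank-submod M A B)

  rank-submod-⊆ : {A B U I : Subset n} → U ⊆ A ∪ B → I ⊆ A ∩ B → r U + r I ≤ r A + r B
  rank-submod-⊆ {A} {B} U⊆ I⊆ =
    ≤-trans (+-mono-≤ (rank-monotone U⊆) (rank-monotone I⊆)) (rank-submod M A B)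

  rank-insert≤ : (A : Subset n) (e : Fin n) → r (A ∪ ⁅ e ⁆) ≤ suc (r A)
  rank-insert≤ A e = begin
    r (A ∪ ⁅ e ⁆)  ≤⟨ rank-∪≤ A ⁅ e ⁆ ⟩
    r A + r ⁅ e ⁆  ≤⟨ +-monoʳ-≤ (r A) r⁅e⁆≤1 ⟩
    r A + 1        ≡⟨ +-comm (r A) 1 ⟩
    suc (r A)      ∎
    where
    open ≤-Reasoning
    r⁅e⁆≤1 = subst (r ⁅ e ⁆ ≤_) (∣⁅x⁆∣≡1 e) (rank-bound M ⁅ e ⁆)

  rank-pos⇒nonempty : {A : Subset n} → 0 < r A → Nonempty A
  rank-pos⇒nonempty {A} 0<rA with nonempty? A
  ... | yes ne = ne
  ... | no empty = contradiction (trans (cong r (Empty-unique empty)) rank-⊥) (>⇒≢ 0<rA)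

  Loopless : Set
  Loopless = ∀ e → r ⁅ e ⁆ ≡ 1

  Spans : Subset n → Fin n → Set
  Spans A e = r (A ∪ ⁅ e ⁆) ≡ r A

  spans? : (A : Subset n) (e : Fin n) → Dec (Spans A e)
  spans? A e = r (A ∪ ⁅ e ⁆) ≟ r A

  ¬spans⇒rank-insert : {A : Subset n} {e : Fin n} → ¬ Spans A e → r (A ∪ ⁅ e ⁆) ≡ suc (r A)
  ¬spans⇒rank-insert {A} {e} ¬span =
    ≤-antisym (rank-insert≤ A e) (≤∧≢⇒< (rank-monotone (p⊆p∪q _)) (¬span ∘ sym))

  spans-∈ : {A : Subset n} {e : Fin n} → e ∈ A → Spans A e
  spans-∈ e∈A = cong r (⊆-antisym (∪-lub ⊆-refl (x∈p⇒⁅x⁆⊆p e∈A)) (p⊆p∪q _))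

  spans-mono : {A B : Subset n} {e : Fin n} → A ⊆ B → Spans A e → Spans B e
  spans-mono {A} {B} {e} A⊆B spanA =
    ≤-antisym (+-cancelʳ-≤ (r A) _ _ submod) (rank-monotone (p⊆p∪q _))
    where
    submod : r (B ∪ ⁅ e ⁆) + r A ≤ r B + r A
    submod = subst (λ t → r (B ∪ ⁅ e ⁆) + r A ≤ r B + t) spanA
      (rank-submod-⊆ (∪-lub (p⊆p∪q _) (q⊆p∪q _ _ ∘ q⊆p∪q A ⁅ e ⁆))
                     (λ x∈A → x∈p∩q⁺ (A⊆B x∈A , p⊆p∪q _ x∈A)))

  rank-∪-spanned : (A B : Subset n) → (∀ {e} → e ∈ B → Spans A e) → r (A ∪ B) ≡ r A
  rank-∪-spanned A B spanned =
    ≤-antisym (bounded ∣ B ∣ B ≤-refl spanned) (rank-monotone (p⊆p∪q B))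
    where
    bounded : ∀ k D → ∣ D ∣ ≤ k → (∀ {e} → e ∈ D → Spans A e) → r (A ∪ D) ≤ r A
    bounded k D ∣D∣≤k spannedD with nonempty? D
    bounded k D ∣D∣≤k spannedD | no empty =
      ≤-reflexive (cong r (trans (cong (A ∪_) (Empty-unique empty)) (∪-identityʳ A)))
    bounded zero D ∣D∣≤0 spannedD | yes (x , x∈D) =
      contradiction (≤-trans (x∈p⇒∣p-x∣<∣p∣ x∈D) ∣D∣≤0) λ ()
    bounded (suc k) D ∣D∣≤1+k spannedD | yes (x , x∈D) = begin
      r (A ∪ D)                  ≤⟨ rank-monotone A∪D⊆ ⟩
      r ((A ∪ (D - x)) ∪ ⁅ x ⁆)  ≡⟨ spans-mono (p⊆p∪q _) (spannedD x∈D) ⟩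
      r (A ∪ (D - x))            ≤⟨ bounded k (D - x) ∣D-x∣≤k (spannedD ∘ p─q⊆p D ⁅ x ⁆) ⟩
      r A                        ∎
      where
      open ≤-Reasoning
      ∣D-x∣≤k = ≤-pred (≤-trans (x∈p⇒∣p-x∣<∣p∣ x∈D) ∣D∣≤1+k)
      A∪D⊆ : A ∪ D ⊆ (A ∪ (D - x)) ∪ ⁅ x ⁆
      A∪D⊆ {y} y∈A∪D with x∈p∪q⁻ A D y∈A∪D | y ≟ᶠ x
      ... | inj₁ y∈A | _ = p⊆p∪q _ (p⊆p∪q _ y∈A)
      ... | inj₂ _ | yes refl = q⊆p∪q _ _ (x∈⁅x⁆ x)
      ... | inj₂ y∈D | no y≢x = p⊆p∪q _ (q⊆p∪q _ _ (x∈p∧x≢y⇒x∈p-y y∈D y≢x))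

  ∈-cl⁺ : {S A : Subset n} {e : Fin n} → e ∈ S → Spans A e → e ∈ cl M S A
  ∈-cl⁺ {A = A} {e} e∈S span = x∈p∩q⁺ (e∈S , lookup⇒[]= e _
    (trans (lookup∘tabulate _ e) (Equivalence.to T-≡ (≡⇒≡ᵇ (r (A ∪ ⁅ e ⁆)) (r A) span))))

  ∈-cl⁻ : {S A : Subset n} {e : Fin n} → e ∈ cl M S A → e ∈ S × Spans A e
  ∈-cl⁻ {S} {A} {e} e∈cl = proj₁ e∈S×e∈T , ≡ᵇ⇒≡ _ _ (Equivalence.from T-≡
    (trans (sym (lookup∘tabulate _ e)) ([]=⇒lookup (proj₂ e∈S×e∈T))))
    where e∈S×e∈T = x∈p∩q⁻ S _ e∈cl

  cl⊆ : (S A : Subset n) → cl M S A ⊆ S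
  cl⊆ S A = p∩q⊆p S _

  ⊆-cl : {S A : Subset n} → A ⊆ S → A ⊆ cl M S A
  ⊆-cl A⊆S e∈A = ∈-cl⁺ (A⊆S e∈A) (spans-∈ e∈A)

  rank-∪-cl : {S B : Subset n} (D : Subset n) → B ⊆ S → r (D ∪ cl M S B) ≡ r (D ∪ B)
  rank-∪-cl {S} {B} D B⊆S = ≤-antisym
    (begin
      r (D ∪ cl M S B)          ≤⟨ rank-monotone (∪-lub (p⊆p∪q _ ∘ p⊆p∪q _) (q⊆p∪q _ _)) ⟩
      r ((D ∪ B) ∪ cl M S B)    ≡⟨ rank-∪-spanned (D ∪ B) (cl M S B)
                                     (spans-mono (q⊆p∪q D B) ∘ proj₂ ∘ ∈-cl⁻) ⟩
      r (D ∪ B)                 ∎)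
    (rank-monotone (∪-lub (p⊆p∪q _) (q⊆p∪q _ _ ∘ ⊆-cl B⊆S)))
    where open ≤-Reasoning

  rank-cl : {S B : Subset n} → B ⊆ S → r (cl M S B) ≡ r B
  rank-cl {S} {B} B⊆S = begin
    r (cl M S B)      ≡⟨ cong r (∪-identityˡ _) ⟨
    r (⊥ ∪ cl M S B)  ≡⟨ rank-∪-cl ⊥ B⊆S ⟩
    r (⊥ ∪ B)         ≡⟨ cong r (∪-identityˡ B) ⟩
    r B               ∎
    where open ≡-Reasoning

  cl-isFlat : {S A : Subset n} → A ⊆ S → IsFlat M S (cl M S A)
  cl-isFlat {S} {A} A⊆S = cl⊆ S A , λ e e∈S e∉cl spanCl → e∉cl (∈-cl⁺ e∈S (begin
    r (A ∪ ⁅ e ⁆)        ≡⟨ cong r (∪-comm A ⁅ e ⁆) ⟩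
    r (⁅ e ⁆ ∪ A)        ≡⟨ rank-∪-cl ⁅ e ⁆ A⊆S ⟨
    r (⁅ e ⁆ ∪ cl M S A)  ≡⟨ cong r (∪-comm ⁅ e ⁆ _) ⟩
    r (cl M S A ∪ ⁅ e ⁆)  ≡⟨ spanCl ⟩
    r (cl M S A)          ≡⟨ rank-cl A⊆S ⟩
    r A                   ∎))
    where open ≡-Reasoning

  cl-least : {S F A : Subset n} → IsFlat M S F → A ⊆ F → cl M S A ⊆ F
  cl-least {F = F} (_ , closed) A⊆F {e} e∈cl with ∈-cl⁻ e∈cl
  ... | e∈S , spanA = decidable-stable (e ∈? F) λ e∉F → closed e e∈S e∉F (spans-mono A⊆F spanA)

  IsFlat-∩ : {S F G : Subset n} → IsFlat M S F → IsFlat M S G → IsFlat M S (F ∩ G)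
  IsFlat-∩ {F = F} {G} (F⊆S , closedF) (_ , closedG) = F⊆S ∘ p∩q⊆p F G , closed
    where
    closed : ∀ e → e ∈ _ → e ∉ F ∩ G → ¬ Spans (F ∩ G) e
    closed e e∈S e∉F∩G span with e ∈? F
    ... | yes e∈F =
      closedG e e∈S (λ e∈G → e∉F∩G (x∈p∩q⁺ (e∈F , e∈G))) (spans-mono (p∩q⊆q F G) span)
    ... | no e∉F = closedF e e∈S e∉F (spans-mono (p∩q⊆p F G) span)

  IsFlat-trans : {S T F : Subset n} → IsFlat M S T → IsFlat M T F → IsFlat M S F
  IsFlat-trans {T = T} (T⊆S , closedT) (F⊆T , closedF) = T⊆S ∘ F⊆T , closed
    where
    closed : ∀ e → e ∈ _ → e ∉ _ → ¬ Spans _ e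
    closed e e∈S e∉F with e ∈? T
    ... | yes e∈T = closedF e e∈T e∉F
    ... | no e∉T = closedT e e∈S e∉T ∘ spans-mono F⊆T

  IsFlat-restrict : {S T F : Subset n} → IsFlat M S F → F ⊆ T → T ⊆ S → IsFlat M T F
  IsFlat-restrict (_ , closed) F⊆T T⊆S = F⊆T , λ e → closed e ∘ T⊆S

  IsModularFlat⁺ : {S X : Subset n} → IsFlat M S X →
                   (∀ Y → IsFlat M S Y → r X + r Y ≡ r (X ∩ Y) + r (X ∪ Y)) →
                   IsModularFlat M S X
  IsModularFlat⁺ {X = X} flatX modular = flatX , λ Y flatY → trans (modular Y flatY)
    (cong (r (X ∩ Y) +_) (sym (rank-cl (∪-lub (proj₁ flatX) (proj₁ flatY)))))

  rank-modular : {S X Y : Subset n} → IsModularFlat M S X → IsFlat M S Y →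
                 r X + r Y ≡ r (X ∩ Y) + r (X ∪ Y)
  rank-modular {X = X} {Y} (flatX , modular) flatY =
    trans (modular Y flatY) (cong (r (X ∩ Y) +_) (rank-cl (∪-lub (proj₁ flatX) (proj₁ flatY))))

  IsModularFlat-∩ : {S X T : Subset n} → IsModularFlat M S X → IsFlat M S T →
                    IsModularFlat M T (X ∩ T)
  IsModularFlat-∩ {S} {X} {T} modX flatT@(T⊆S , _) =
    IsModularFlat⁺ (IsFlat-restrict (IsFlat-∩ (proj₁ modX) flatT) (p∩q⊆q X T) T⊆S) modular
    where
    modular : ∀ Y → IsFlat M T Y → r (X ∩ T) + r Y ≡ r ((X ∩ T) ∩ Y) + r ((X ∩ T) ∪ Y)
    modular Y flatY@(Y⊆T , _) = subst₂ (λ i w → r (X ∩ T) + r Y ≡ r i + w) X∩Y≡ (rank-cl B⊆S)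
      (difference (r X) (r (X ∩ T)) (r (X ∩ Y)) modX∪W modXY)
      where
      B = (X ∩ T) ∪ Y
      W = cl M S B
      B⊆S : B ⊆ S
      B⊆S = T⊆S ∘ ∪-lub (p∩q⊆q X T) Y⊆T
      X∩W≡X∩T : X ∩ W ≡ X ∩ T
      X∩W≡X∩T = ⊆-antisym
        (λ x∈X∩W → x∈p∩q⁺ (p∩q⊆p X W x∈X∩W , W⊆T (p∩q⊆q X W x∈X∩W)))
        (λ x∈X∩T → x∈p∩q⁺ (p∩q⊆p X T x∈X∩T , ⊆-cl B⊆S (p⊆p∪q Y x∈X∩T)))
        where W⊆T = cl-least flatT (∪-lub (p∩q⊆q X T) Y⊆T)
      X∪B≡X∪Y : X ∪ B ≡ X ∪ Y
      X∪B≡X∪Y = trans (sym (∪-assoc X (X ∩ T) Y)) (cong (_∪ Y) (∪-abs-∩ X T))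
      X∩Y≡ : X ∩ Y ≡ (X ∩ T) ∩ Y
      X∩Y≡ = trans (cong (X ∩_) (sym (trans (∩-comm T Y) (p⊆q⇒p∩q≡p Y⊆T))))
                   (sym (∩-assoc X T Y))
      modX∪W : r X + r W ≡ r (X ∩ T) + r (X ∪ Y)
      modX∪W = trans (rank-modular modX (cl-isFlat B⊆S))
        (cong₂ _+_ (cong r X∩W≡X∩T) (trans (rank-∪-cl X B⊆S) (cong r X∪B≡X∪Y)))
      modXY : r X + r Y ≡ r (X ∩ Y) + r (X ∪ Y)
      modXY = rank-modular modX (IsFlat-trans flatT flatY)
      difference : ∀ a c i {w u y} → a + w ≡ c + u → a + y ≡ i + u → c + y ≡ i + w
      difference a c i {w} {u} {y} eq₁ eq₂ = +-cancelʳ-≡ u _ _ (begin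
        c + y + u  ≡⟨ xy∙z≈xz∙y c y u ⟩
        c + u + y  ≡⟨ cong (_+ y) eq₁ ⟨
        a + w + y  ≡⟨ xy∙z≈xz∙y a w y ⟩
        a + y + w  ≡⟨ cong (_+ w) eq₂ ⟩
        i + u + w  ≡⟨ xy∙z≈xz∙y i u w ⟩
        i + w + u  ∎)
        where
        open ≡-Reasoning
        open CommutativeSemigroupProperties +-commutativeSemigroup using (xy∙z≈xz∙y)

  rank-insert-flat : {S F : Subset n} {e : Fin n} → IsFlat M S F → e ∈ S → e ∉ F →
                     r (F ∪ ⁅ e ⁆) ≡ suc (r F)
  rank-insert-flat (_ , closed) e∈S e∉F = ¬spans⇒rank-insert (closed _ e∈S e∉F)

  rank-∩-coatom : {S X H : Subset n} {e : Fin n} → IsModularFlat M S X → IsCoatom M S H →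
                  e ∈ X → e ∉ H → suc (r (X ∩ H)) ≡ r X
  rank-∩-coatom {S} {X} {H} {e} modX (flatH , coatom) e∈X e∉H = +-cancelʳ-≡ (r H) _ _ (begin
    suc (r (X ∩ H)) + r H  ≡⟨ +-suc (r (X ∩ H)) (r H) ⟨
    r (X ∩ H) + suc (r H)  ≡⟨ cong (r (X ∩ H) +_) rank-X∪H ⟨
    r (X ∩ H) + r (X ∪ H)  ≡⟨ rank-modular modX flatH ⟨
    r X + r H              ∎)
    where
    open ≡-Reasoning
    X⊆S = proj₁ (proj₁ modX)
    rank-X∪H : r (X ∪ H) ≡ suc (r H)
    rank-X∪H = ≤-antisym
      (≤-trans (rank-monotone (∪-lub X⊆S (proj₁ flatH))) (≤-reflexive (sym coatom)))
      (≤-trans (≤-reflexive (sym (rank-insert-flat flatH (X⊆S e∈X) e∉H)))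
               (rank-monotone (∪-lub (q⊆p∪q X H) (p⊆p∪q H ∘ x∈p⇒⁅x⁆⊆p e∈X))))

  spans-exchange : {A : Subset n} {e f : Fin n} →
                   ¬ Spans A e → Spans (A ∪ ⁅ f ⁆) e → Spans (A ∪ ⁅ e ⁆) f
  spans-exchange {A} {e} {f} ¬spanAe spanAfe = ≤-antisym (begin
    r ((A ∪ ⁅ e ⁆) ∪ ⁅ f ⁆)  ≡⟨ cong r (p∪q∪r≡p∪r∪q A ⁅ e ⁆ ⁅ f ⁆) ⟩
    r ((A ∪ ⁅ f ⁆) ∪ ⁅ e ⁆)  ≡⟨ spanAfe ⟩
    r (A ∪ ⁅ f ⁆)            ≤⟨ rank-insert≤ A f ⟩
    suc (r A)                ≡⟨ ¬spans⇒rank-insert ¬spanAe ⟨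
    r (A ∪ ⁅ e ⁆)            ∎)
    (rank-monotone (p⊆p∪q _))
    where open ≤-Reasoning

  Skew : Subset n → Subset n → Set
  Skew C Z = r (C ∪ Z) ≡ r C + r Z

  skew-insert : {C Z : Subset n} {f : Fin n} →
                Skew C Z → ¬ Spans (C ∪ Z) f → Skew (C ∪ ⁅ f ⁆) Z
  skew-insert {C} {Z} {f} skew ¬span = ≤-antisym (rank-∪≤ _ Z) (begin
    r (C ∪ ⁅ f ⁆) + r Z  ≤⟨ +-monoˡ-≤ (r Z) (rank-insert≤ C f) ⟩
    suc (r C + r Z)      ≡⟨ cong suc skew ⟨
    suc (r (C ∪ Z))      ≡⟨ ¬spans⇒rank-insert ¬span ⟨
    r ((C ∪ Z) ∪ ⁅ f ⁆)  ≡⟨ cong r (p∪q∪r≡p∪r∪q C Z ⁅ f ⁆) ⟩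
    r ((C ∪ ⁅ f ⁆) ∪ Z)  ∎)
    where open ≤-Reasoning

  skew-¬spans : {C Z : Subset n} {z : Fin n} → Skew C Z → z ∈ Z → r ⁅ z ⁆ ≡ 1 → ¬ Spans C z
  skew-¬spans {C} {Z} {z} skew z∈Z r⁅z⁆≡1 spanCz = <-irrefl refl (begin-strict
    r C + r Z                ≡⟨ skew ⟨
    r (C ∪ Z)                <⟨ m<m+n (r (C ∪ Z)) (s≤s z≤n) ⟩
    r (C ∪ Z) + 1            ≡⟨ cong (r (C ∪ Z) +_) r⁅z⁆≡1 ⟨
    r (C ∪ Z) + r ⁅ z ⁆      ≤⟨ rank-submod-⊆ (∪-lub (p⊆p∪q _ ∘ p⊆p∪q _) (q⊆p∪q _ _)) ⁅z⁆⊆ ⟩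
    r (C ∪ ⁅ z ⁆) + r Z      ≡⟨ cong (_+ r Z) spanCz ⟩
    r C + r Z                ∎)
    where
    open ≤-Reasoning
    ⁅z⁆⊆ : ⁅ z ⁆ ⊆ (C ∪ ⁅ z ⁆) ∩ Z
    ⁅z⁆⊆ y∈⁅z⁆ = x∈p∩q⁺ (q⊆p∪q C _ y∈⁅z⁆ , x∈p⇒⁅x⁆⊆p z∈Z y∈⁅z⁆)

  record Complement (S Z : Subset n) : Set where
    field
      C        : Subset n
      C⊆S      : C ⊆ S
      skew     : Skew C Z
      spanning : ∀ {f} → f ∈ S → Spans (C ∪ Z) f

  complement : {S Z : Subset n} → Z ⊆ S → Complement S Z
  complement {S} {Z} Z⊆S = grow (r S) ⊥ (⊆-min S) skew-⊥ (m≤n+m (r S) _)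
    where
    skew-⊥ : Skew ⊥ Z
    skew-⊥ = trans (cong r (∪-identityˡ Z)) (cong (_+ r Z) (sym rank-⊥))
    grow : ∀ k C → C ⊆ S → Skew C Z → r S ≤ r (C ∪ Z) + k → Complement S Z
    grow k C C⊆S skew r[S]≤ with any? (λ f → (f ∈? S) ×-dec ¬? (spans? (C ∪ Z) f))
    ... | no none = record
      { C = C ; C⊆S = C⊆S ; skew = skew
      ; spanning = λ {f} f∈S →
          decidable-stable (spans? _ f) (λ ¬span → none (f , f∈S , ¬span)) }
    ... | yes (f , f∈S , ¬span) with k | x∈p⇒⁅x⁆⊆p f∈S
    ...   | zero | ⁅f⁆⊆S = ⊥-elim (<-irrefl refl (begin-strict
      r (C ∪ Z)            <⟨ n<1+n _ ⟩
      suc (r (C ∪ Z))      ≡⟨ ¬spans⇒rank-insert ¬span ⟨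
      r ((C ∪ Z) ∪ ⁅ f ⁆)  ≤⟨ rank-monotone (∪-lub (∪-lub C⊆S Z⊆S) ⁅f⁆⊆S) ⟩
      r S                  ≤⟨ r[S]≤ ⟩
      r (C ∪ Z) + 0        ≡⟨ +-identityʳ _ ⟩
      r (C ∪ Z)            ∎))
      where open ≤-Reasoning
    ...   | suc k | ⁅f⁆⊆S = grow k (C ∪ ⁅ f ⁆) (∪-lub C⊆S ⁅f⁆⊆S) (skew-insert skew ¬span) (begin
      r S                          ≤⟨ r[S]≤ ⟩
      r (C ∪ Z) + suc k            ≡⟨ +-suc _ k ⟩
      suc (r (C ∪ Z)) + k          ≡⟨ cong (_+ k) (¬spans⇒rank-insert ¬span) ⟨
      r ((C ∪ Z) ∪ ⁅ f ⁆) + k      ≡⟨ cong (λ A → r A + k) (p∪q∪r≡p∪r∪q C Z ⁅ f ⁆) ⟩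
      r ((C ∪ ⁅ f ⁆) ∪ Z) + k      ∎)
      where open ≤-Reasoning

  module Extension {S Z : Subset n} (modZ : IsModularFlat M S Z) where

    open Complement (complement (proj₁ (proj₁ modZ)))

    extend : Subset n → Subset n
    extend F = cl M S (F ∪ C)

    extend-isProperFlat : {F : Subset n} → IsProperFlat M Z F → IsProperFlat M S (extend F)
    extend-isProperFlat {F} (flatF@(F⊆Z , _) , F≢Z) = cl-isFlat F∪C⊆S , λ W≡S →
      let z , z∈Z , z∉F = p⊈q⇒∃ (λ Z⊆F → F≢Z (⊆-antisym F⊆Z Z⊆F))
          z∈W = subst (z ∈_) (sym W≡S) (Z⊆S z∈Z)
      in <-irrefl refl (begin-strict
        r F + (r C + r Z)        <⟨ +-monoˡ-< (r C + r Z) (n<1+n (r F)) ⟩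
        suc (r F) + (r C + r Z)  ≡⟨ cong (_+ (r C + r Z)) (rank-insert-flat flatF z∈Z z∉F) ⟨
        r (F ∪ ⁅ z ⁆) + (r C + r Z)
          ≤⟨ +-mono-≤ (rank-monotone (∪-lub F⊆Z∩W (x∈p⇒⁅x⁆⊆p (x∈p∩q⁺ (z∈Z , z∈W)))))
                      (≤-trans (≤-reflexive (sym skew)) (rank-monotone C∪Z⊆Z∪W)) ⟩
        r (Z ∩ W) + r (Z ∪ W)    ≡⟨ rank-modular modZ (cl-isFlat F∪C⊆S) ⟨
        r Z + r W                ≡⟨ cong (r Z +_) (rank-cl F∪C⊆S) ⟩
        r Z + r (F ∪ C)          ≤⟨ +-monoʳ-≤ (r Z) (rank-∪≤ F C) ⟩
        r Z + (r F + r C)        ≡⟨ x∙yz≈y∙zx (r Z) (r F) (r C) ⟩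
        r F + (r C + r Z)        ∎)
      where
      open ≤-Reasoning
      open CommutativeSemigroupProperties +-commutativeSemigroup using (x∙yz≈y∙zx)
      Z⊆S = proj₁ (proj₁ modZ)
      F∪C⊆S = ∪-lub (Z⊆S ∘ F⊆Z) C⊆S
      W = extend F
      F⊆Z∩W : F ⊆ Z ∩ W
      F⊆Z∩W x∈F = x∈p∩q⁺ (F⊆Z x∈F , ⊆-cl F∪C⊆S (p⊆p∪q C x∈F))
      C∪Z⊆Z∪W : C ∪ Z ⊆ Z ∪ W
      C∪Z⊆Z∪W = ∪-lub (q⊆p∪q Z W ∘ ⊆-cl F∪C⊆S ∘ q⊆p∪q F C) (p⊆p∪q W)

    rank-Z∩extension≡1 : {f : Fin n} → f ∈ S → ¬ Spans C f →
                         r (Z ∩ cl M S (C ∪ ⁅ f ⁆)) ≡ 1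
    rank-Z∩extension≡1 {f} f∈S ¬spanCf = +-cancelʳ-≡ (r C + r Z) _ _ (begin
      r (Z ∩ W) + (r C + r Z)  ≡⟨ cong (r (Z ∩ W) +_) rank-Z∪W ⟨
      r (Z ∩ W) + r (Z ∪ W)    ≡⟨ rank-modular modZ (cl-isFlat C∪f⊆S) ⟨
      r Z + r W                ≡⟨ cong (r Z +_) (rank-cl C∪f⊆S) ⟩
      r Z + r (C ∪ ⁅ f ⁆)      ≡⟨ cong (r Z +_) (¬spans⇒rank-insert ¬spanCf) ⟩
      r Z + suc (r C)          ≡⟨ +-suc (r Z) (r C) ⟩
      suc (r Z + r C)          ≡⟨ cong suc (+-comm (r Z) (r C)) ⟩
      1 + (r C + r Z)          ∎)
      where
      open ≡-Reasoning
      C∪f⊆S = ∪-lub C⊆S (x∈p⇒⁅x⁆⊆p f∈S)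
      W = cl M S (C ∪ ⁅ f ⁆)
      rank-Z∪W : r (Z ∪ W) ≡ r C + r Z
      rank-Z∪W = begin
        r (Z ∪ W)              ≡⟨ rank-∪-cl Z C∪f⊆S ⟩
        r (Z ∪ (C ∪ ⁅ f ⁆))    ≡⟨ cong r (∪-assoc Z C ⁅ f ⁆) ⟨
        r ((Z ∪ C) ∪ ⁅ f ⁆)    ≡⟨ cong (λ A → r (A ∪ ⁅ f ⁆)) (∪-comm Z C) ⟩
        r ((C ∪ Z) ∪ ⁅ f ⁆)    ≡⟨ spanning f∈S ⟩
        r (C ∪ Z)              ≡⟨ skew ⟩
        r C + r Z              ∎

    extend-cover : Loopless → {F₁ F₂ : Subset n} → F₁ ∪ F₂ ≡ Z →
                   S ⊆ extend F₁ ∪ extend F₂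
    extend-cover loopless {F₁} {F₂} F₁∪F₂≡Z {f} f∈S with spans? C f
    ... | yes spanCf = p⊆p∪q _ (∈-cl⁺ f∈S (spans-mono (q⊆p∪q F₁ C) spanCf))
    ... | no ¬spanCf =
      [ p⊆p∪q _ ∘ ∈-extend , q⊆p∪q _ _ ∘ ∈-extend ] (x∈p∪q⁻ F₁ F₂ z∈F₁∪F₂)
      where
      z,z∈Z∩W = rank-pos⇒nonempty
        (subst (0 <_) (sym (rank-Z∩extension≡1 f∈S ¬spanCf)) (s≤s z≤n))
      z = proj₁ z,z∈Z∩W
      z∈Z = p∩q⊆p Z _ (proj₂ z,z∈Z∩W)
      z∈F₁∪F₂ = subst (z ∈_) (sym F₁∪F₂≡Z) z∈Z
      spanCfz : Spans (C ∪ ⁅ f ⁆) z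
      spanCfz = proj₂ (∈-cl⁻ (p∩q⊆q Z _ (proj₂ z,z∈Z∩W)))
      ∈-extend : {F : Subset n} → z ∈ F → f ∈ extend F
      ∈-extend {F} z∈F = ∈-cl⁺ f∈S
        (spans-mono (∪-lub (q⊆p∪q F C) (p⊆p∪q C ∘ x∈p⇒⁅x⁆⊆p z∈F))
                    (spans-exchange (skew-¬spans skew z∈Z (loopless z)) spanCfz))

  Round-modularFlat : {S Z : Subset n} → Loopless →
                      Round M S → IsModularFlat M S Z → Round M Z
  Round-modularFlat loopless round modZ (F₁ , F₂ , properF₁ , properF₂ , F₁∪F₂≡Z) =
    round (extend F₁ , extend F₂ , extend-isProperFlat properF₁ , extend-isProperFlat properF₂ ,
           ⊆-antisym (∪-lub (cl⊆ _ _) (cl⊆ _ _)) (extend-cover loopless F₁∪F₂≡Z))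
    where open Extension modZ

  IsModularFlat-∩ˡ : {S X E : Subset n} → IsModularFlat M S E → IsFlat M S X →
                     IsModularFlat M X (X ∩ E)
  IsModularFlat-∩ˡ {X = X} {E} modE flatX =
    subst (IsModularFlat M X) (∩-comm E X) (IsModularFlat-∩ modE flatX)

  IsModularFlat-⊆ : {S X E : Subset n} → IsModularFlat M S X → IsFlat M S E → X ⊆ E →
                    IsModularFlat M E X
  IsModularFlat-⊆ modX flatE X⊆E =
    subst (IsModularFlat M _) (p⊆q⇒p∩q≡p X⊆E) (IsModularFlat-∩ modX flatE)

  ME-modularFlat : {S X : Subset n} → Loopless → ME M S → IsModularFlat M S X → ME M X
  ME-modularFlat loopless me-empty ((X⊆⊥ , _) , _) =
    subst (ME M) (⊆-antisym (⊆-min _) X⊆⊥) me-empty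
  ME-modularFlat {X = X} loopless (me-coatom S H modH coatomH meH) modX with X ⊆? H
  ... | yes X⊆H = ME-modularFlat loopless meH (IsModularFlat-⊆ modX (proj₁ modH) X⊆H)
  ... | no X⊈H =
    let _ , e∈X , e∉H = p⊈q⇒∃ X⊈H
        modX∩H = IsModularFlat-∩ˡ modH (proj₁ modX)
    in me-coatom X (X ∩ H) modX∩H (proj₁ modX∩H , rank-∩-coatom modX coatomH e∈X e∉H)
         (ME-modularFlat loopless meH (IsModularFlat-∩ modX (proj₁ modH)))
  ME-modularFlat {X = X} loopless
                 (me-join S E₁ E₂ modE₁ _ modE₂ _ E₁∪E₂≡S round meE₁ meE₂) modX
    with X ⊆? E₁ | X ⊆? E₂
  ... | yes X⊆E₁ | _ = ME-modularFlat loopless meE₁ (IsModularFlat-⊆ modX (proj₁ modE₁) X⊆E₁)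
  ... | no _ | yes X⊆E₂ = ME-modularFlat loopless meE₂ (IsModularFlat-⊆ modX (proj₁ modE₂) X⊆E₂)
  ... | no X⊈E₁ | no X⊈E₂ =
    me-join X (X ∩ E₁) (X ∩ E₂)
      (IsModularFlat-∩ˡ modE₁ flatX) (X⊈E₁ ∘ p∩q≡p⇒p⊆q)
      (IsModularFlat-∩ˡ modE₂ flatX) (X⊈E₂ ∘ p∩q≡p⇒p⊆q)
      cover round∩
      (ME-modularFlat loopless meE₁ (IsModularFlat-∩ modX flatE₁))
      (ME-modularFlat loopless meE₂ (IsModularFlat-∩ modX flatE₂))
    where
    open IdempotentCommutativeMonoidProperties (∩-idempotentCommutativeMonoid n) using (∙-distrˡ-∙)
    flatX = proj₁ modX
    flatE₁ = proj₁ modE₁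
    flatE₂ = proj₁ modE₂
    cover : (X ∩ E₁) ∪ (X ∩ E₂) ≡ X
    cover = begin
      (X ∩ E₁) ∪ (X ∩ E₂)  ≡⟨ ∩-distribˡ-∪ X E₁ E₂ ⟨
      X ∩ (E₁ ∪ E₂)        ≡⟨ cong (X ∩_) E₁∪E₂≡S ⟩
      X ∩ S                ≡⟨ p⊆q⇒p∩q≡p (proj₁ flatX) ⟩
      X                    ∎
      where open ≡-Reasoning
    round∩ : Round M ((X ∩ E₁) ∩ (X ∩ E₂))
    round∩ = subst (Round M) (∙-distrˡ-∙ X E₁ E₂)
      (Round-modularFlat loopless round (IsModularFlat-∩ modX (IsFlat-∩ flatE₁ flatE₂)))

lemma3p1 : ∀ {n} (M : Matroid n) → Simple M → ME M ⊤ →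
             ∀ (X : Subset n) → IsModularFlat M ⊤ X → ME M X
lemma3p1 M simple me X modX = ME-modularFlat M (proj₁ simple) me modX
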